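{- Let $G$ be a niche-realizable graph. Then every component of $G$ has a Hamilton path, and every component of $G$ that is $2$-connected is hamiltonian.
   Context: All graphs are simple. A bipartite tournament is an orientation of a complete bipartite graph. The niche graph of a digraph $D$ is the graph with vertex set $V(D)$ in which distinct $u,v$ are adjacent iff there is a vertex $w$ with $(u,w),(v,w)\in A(D)$, or with $(w,u),(w,v)\in A(D)$. A graph is niche-realizable if it is the niche graph of some bipartite tournament. -}

module Defs where

open import Data.Nat using (ℕ; _≤_)
open import Data.Fin using (Fin)
open import Data.Bool using (Bool; true; false)
open import Data.Product using (Σ; _×_; _,_; ∃; ∃-syntax)
open import Data.Sum using (_⊎_)
open import Data.Unit using (⊤)
open import Data.List using (List; []; _∷_; length; last)
open import Data.Maybe using (just)
open import Data.List.Membership.Propositional using (_∈_)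
open import Data.List.Relation.Unary.Linked using (Linked)
open import Data.List.Relation.Unary.Unique.Propositional using (Unique)
open import Relation.Nullary using (¬_)
open import Relation.Binary.PropositionalEquality using (_≡_; _≢_)
open import Function.Bundles using (_⇔_)

record Graph (n : ℕ) : Set where
  field
    adj     : Fin n → Fin n → Bool
    sym     : ∀ u v → adj u v ≡ adj v u
    irrefl  : ∀ u → adj u u ≡ false

-- A bipartite tournament on vertex set Fin n: an orientation of the complete
-- bipartite graph with parts {v | side v ≡ true} and {v | side v ≡ false}.
record BipartiteTournament (n : ℕ) : Set where
  field
    side      : Fin n → Bool
    arc       : Fin n → Fin n → Bool
    arc-same  : ∀ u v → side u ≡ side v → arc u v ≡ false
    arc-diff  : ∀ u v → side u ≢ side v → (arc u v ≡ true) ⊎ (arc v u ≡ true)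
    arc-asym  : ∀ u v → arc u v ≡ true → arc v u ≡ false

NicheAdj : ∀ {n} → BipartiteTournament n → Fin n → Fin n → Set
NicheAdj D u v =
  u ≢ v ×
  ( (∃[ w ] (arc u w ≡ true × arc v w ≡ true))
  ⊎ (∃[ w ] (arc w u ≡ true × arc w v ≡ true)) )
  where open BipartiteTournament D

IsNicheGraphOf : ∀ {n} → Graph n → BipartiteTournament n → Set
IsNicheGraphOf G D = ∀ u v → (Graph.adj G u v ≡ true) ⇔ NicheAdj D u v

NicheRealizable : ∀ {n} → Graph n → Set
NicheRealizable {n} G = Σ (BipartiteTournament n) (IsNicheGraphOf G)

module _ {n : ℕ} (G : Graph n) where
  open Graph G

  Adj : Fin n → Fin n → Set
  Adj u v = adj u v ≡ true

  data ReachIn (P : Fin n → Set) : Fin n → Fin n → Set where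
    here : ∀ {a} → P a → ReachIn P a a
    step : ∀ {a c b} → P a → Adj a c → ReachIn P c b → ReachIn P a b

  Reachable : Fin n → Fin n → Set
  Reachable = ReachIn (λ _ → ⊤)

  InComp : Fin n → Fin n → Set
  InComp v u = Reachable v u

  HamPathOfComp : Fin n → Set
  HamPathOfComp v =
    Σ (List (Fin n)) λ xs →
      Linked Adj xs × Unique xs × (∀ u → (u ∈ xs) ⇔ InComp v u)

  TwoConnectedComp : Fin n → Set
  TwoConnectedComp v =
    (∃[ a ] ∃[ b ] ∃[ c ]
       (InComp v a × InComp v b × InComp v c × a ≢ b × b ≢ c × a ≢ c))
    × (∀ x a b → InComp v x → InComp v a → InComp v b → a ≢ x → b ≢ x →
         ReachIn (λ y → InComp v y × y ≢ x) a b)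

  HamiltonianComp : Fin n → Set
  HamiltonianComp v =
    Σ (Fin n) λ x₀ → Σ (List (Fin n)) λ xs →
      3 ≤ length (x₀ ∷ xs) ×
      Linked Adj (x₀ ∷ xs) ×
      (∃[ y ] (last (x₀ ∷ xs) ≡ just y × Adj y x₀)) ×
      Unique (x₀ ∷ xs) ×
      (∀ u → (u ∈ (x₀ ∷ xs)) ⇔ InComp v u)

module Submission where

-- Two vertices of the niche graph of a bipartite tournament can only be adjacent if they lie in
-- the same part, and two distinct vertices a, b of one part are adjacent unless their arcs to the
-- other part all point in opposite directions.  Relative to a vertex p, its part therefore splits
-- into the twins of p (same arcs; a clique containing p), its antitwins (opposite arcs; a clique
-- with no edge to the twins) and the mixed vertices, which are adjacent to every twin and every
-- antitwin.  Recursing on the mixed vertices, the vertices of one part are covered by at most two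
-- mutually non-adjacent paths.  For the part of v, interleaving the paths on the twins and
-- antitwins with those on the mixed vertices (all edges in between are present) gives a Hamilton
-- path of the component of v, and a Hamilton cycle as soon as both sides can be cut into equally
-- many paths; this fails only when a single vertex separates the component, which 2-connectivity
-- excludes.  If the other part is empty, v is isolated.

open import Defs
open import Data.Nat using (ℕ; suc; pred; _≤_; z≤n; s≤s)
open import Data.Nat.Properties using (≤-total; ≤-trans; ≤-refl; n≤1+n; +-comm)
open import Data.Fin using (Fin; _≟_)
import Data.Fin.Properties as Fin
open import Data.Bool using (Bool; true; false)
import Data.Bool.Properties as Bool
open import Data.Product using (_×_; _,_; ∃-syntax; proj₁; proj₂)
open import Data.Sum using (_⊎_; inj₁; inj₂)
open import Data.Unit using (tt)
open import Data.Empty using (⊥; ⊥-elim)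
open import Data.List
  using (List; []; _∷_; [_]; _++_; _∷ʳ_; concat; length; last; head; filter; allFin)
open import Data.List.Properties
  using (++-identityʳ; ++-assoc; length-++; length-++-sucʳ; filter-accept; filter-reject;
         length-filter)
open import Data.Maybe using (just)
import Data.Maybe.Relation.Unary.All as Maybe
open import Data.Maybe.Relation.Binary.Connected using (Connected)
import Data.Maybe.Relation.Binary.Connected as Connected
open import Data.List.Membership.Propositional using (_∈_)
open import Data.List.Membership.Propositional.Properties
  using (∈-++⁺ˡ; ∈-++⁺ʳ; ∈-++⁻; ∈-∃++; ∈-filter⁺; ∈-allFin)
open import Data.List.Relation.Binary.Subset.Propositional using (_⊆_)
open import Data.List.Relation.Unary.Any using (here; there)
open import Data.List.Relation.Unary.All as All using (All; []; _∷_)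
import Data.List.Relation.Unary.All.Properties as All
open import Data.List.Relation.Unary.AllPairs using (AllPairs; []; _∷_)
open import Data.List.Relation.Unary.Linked using (Linked; []; [-]; _∷_)
import Data.List.Relation.Unary.Linked as Linked
import Data.List.Relation.Unary.Linked.Properties as Linkedₚ
open import Data.List.Relation.Unary.Unique.Propositional using (Unique)
import Data.List.Relation.Unary.Unique.Propositional.Properties as Unique
open import Data.List.Relation.Binary.Permutation.Propositional
  using (_↭_; ↭-refl; ↭-sym; ↭-trans; ↭-reflexive; ↭-prep; ↭⇒↭ₛ; module PermutationReasoning)
open import Data.List.Relation.Binary.Permutation.Propositional.Properties
  using (++⁺ˡ; ++⁺; ++-comm; shift; shifts; All-resp-↭; ∈-resp-↭; ¬x∷xs↭[]; ↭-length)
import Data.List.Relation.Binary.Permutation.Setoid.Properties as Permutation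
open import Relation.Nullary using (¬_; Dec; yes; no; ¬?)
open import Relation.Nullary.Decidable using (_×-dec_; _→-dec_; decidable-stable)
open import Function.Base using (_∘_)
open import Function.Bundles using (_⇔_; mk⇔; Equivalence)
open import Relation.Binary.PropositionalEquality
  using (_≡_; _≢_; refl; sym; trans; cong; subst; setoid; module ≡-Reasoning)

-- Interleaving paths

Complete : {A : Set} → (A → A → Set) → (A → Set) → (A → Set) → Set
Complete R X Y = ∀ {x y} → X x → Y y → R x y

Apart : {A : Set} → (A → A → Set) → List A → List A → Set
Apart R p q = ∀ {x y} → x ∈ p → y ∈ q → ¬ R x y

record IsPath {A : Set} (R : A → A → Set) (p : List A) : Set where
  field
    nonEmpty : p ≢ []
    linked   : Linked R p

open IsPath

weave : {A : Set} → List (List A) → List (List A) → List A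
weave []       qs       = concat qs
weave (p ∷ ps) []       = p ++ concat ps
weave (p ∷ ps) (q ∷ qs) = p ++ q ++ weave ps qs

Balanced : {A : Set} → List (List A) → List (List A) → Set
Balanced ps qs = length qs ≤ length ps × length ps ≤ suc (length qs)

module _ {A : Set} where

  length-∷ʳ : ∀ (xs : List A) x → length (xs ∷ʳ x) ≡ suc (length xs)
  length-∷ʳ xs x = trans (length-++ xs) (+-comm (length xs) 1)

  weave-↭ : (ps qs : List (List A)) → weave ps qs ↭ concat ps ++ concat qs
  weave-↭ []       qs       = ↭-refl
  weave-↭ (p ∷ ps) []       = ↭-reflexive (sym (++-identityʳ _))
  weave-↭ (p ∷ ps) (q ∷ qs) = begin
    p ++ q ++ weave ps qs                ↭⟨ ++⁺ˡ p (++⁺ˡ q (weave-↭ ps qs)) ⟩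
    p ++ q ++ concat ps ++ concat qs     ↭⟨ ++⁺ˡ p (shifts q (concat ps)) ⟩
    p ++ concat ps ++ q ++ concat qs     ≡⟨ ++-assoc p (concat ps) _ ⟨
    (p ++ concat ps) ++ q ++ concat qs   ∎
    where open PermutationReasoning

  weave-∷ʳ : ∀ (ps qs : List (List A)) r → length ps ≡ length qs →
             weave (ps ∷ʳ r) qs ≡ weave ps qs ++ r
  weave-∷ʳ []       []       r _  = ++-identityʳ r
  weave-∷ʳ (p ∷ ps) (q ∷ qs) r eq = begin
    p ++ q ++ weave (ps ∷ʳ r) qs    ≡⟨ cong (λ w → p ++ q ++ w) (weave-∷ʳ ps qs r (cong pred eq)) ⟩
    p ++ q ++ (weave ps qs ++ r)    ≡⟨ cong (p ++_) (++-assoc q _ r) ⟨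
    p ++ (q ++ weave ps qs) ++ r    ≡⟨ ++-assoc p _ r ⟨
    (p ++ q ++ weave ps qs) ++ r    ∎
    where open ≡-Reasoning

module _ {A : Set} {R : A → A → Set} where

  ∷-path : ∀ {x xs} → Linked R (x ∷ xs) → IsPath R (x ∷ xs)
  ∷-path lk = record { nonEmpty = λ () ; linked = lk }

  path-member : ∀ {p} → IsPath R p → ∃[ x ] x ∈ p
  path-member {[]}    π = ⊥-elim (nonEmpty π refl)
  path-member {x ∷ _} _ = x , here refl

  connected : ∀ {X Y : A → Set} {mx my} → Complete R X Y →
              Maybe.All X mx → Maybe.All Y my → Connected R mx my
  connected X~Y (Maybe.just x) (Maybe.just y) = Connected.just (X~Y x y)
  connected X~Y (Maybe.just _) Maybe.nothing  = Connected.just-nothing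
  connected X~Y Maybe.nothing  (Maybe.just _) = Connected.nothing-just
  connected X~Y Maybe.nothing  Maybe.nothing  = Connected.nothing

  head-++⁺ : ∀ {P : A → Set} {p} ys → IsPath R p → All P p → Maybe.All P (head (p ++ ys))
  head-++⁺ {p = []}    _ π _        = ⊥-elim (nonEmpty π refl)
  head-++⁺ {p = _ ∷ _} _ _ (px ∷ _) = Maybe.just px

  weave-head⁺ : ∀ {X : A → Set} {ps qs} → All (IsPath R) ps → All (All X) ps →
                Balanced ps qs → Maybe.All X (head (weave ps qs))
  weave-head⁺ {qs = []}    []      []      _        = Maybe.nothing
  weave-head⁺ {qs = _ ∷ _} []      []      (() , _)
  weave-head⁺ {qs = []}    (π ∷ _) (x ∷ _) _        = head-++⁺ _ π x
  weave-head⁺ {qs = _ ∷ _} (π ∷ _) (x ∷ _) _        = head-++⁺ _ π x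

  weave-linked : ∀ {X Y : A → Set} {ps qs} → Complete R X Y → Complete R Y X →
                 All (IsPath R) ps → All (All X) ps → All (IsPath R) qs → All (All Y) qs →
                 Balanced ps qs → Linked R (weave ps qs)
  weave-linked _ _ [] [] [] [] _ = []
  weave-linked _ _ [] [] (_ ∷ _) _ (() , _)
  weave-linked X~Y _ (π ∷ []) (x ∷ []) [] [] _ =
    Linkedₚ.++⁺ (linked π) (connected X~Y (All.last⁺ x) Maybe.nothing) []
  weave-linked _ _ (_ ∷ _ ∷ _) _ [] [] (_ , s≤s ())
  weave-linked X~Y Y~X (π ∷ πs) (x ∷ xs) (σ ∷ σs) (y ∷ ys) (s≤s b₁ , s≤s b₂) =
    Linkedₚ.++⁺ (linked π) (connected X~Y (All.last⁺ x) (head-++⁺ _ σ y))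
      (Linkedₚ.++⁺ (linked σ) (connected Y~X (All.last⁺ y) (weave-head⁺ πs xs (b₁ , b₂)))
        (weave-linked X~Y Y~X πs xs σs ys (b₁ , b₂)))

  -- The closing edge: with the one-vertex path [ x₀ ] appended to ps the system is still
  -- balanced, so the interleaving runs on into x₀.
  weave-cycle : ∀ {X Y : A → Set} {x₀ p ps q qs} → Complete R X Y → Complete R Y X →
                All (IsPath R) ((x₀ ∷ p) ∷ ps) → All (All X) ((x₀ ∷ p) ∷ ps) →
                All (IsPath R) (q ∷ qs) → All (All Y) (q ∷ qs) → length ps ≡ length qs →
                Linked R (weave ((x₀ ∷ p) ∷ ps) (q ∷ qs) ∷ʳ x₀)
  weave-cycle {x₀ = x₀} {p} {ps} {q} {qs} X~Y Y~X πs xs σs ys eq =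
    subst (Linked R) (weave-∷ʳ ((x₀ ∷ p) ∷ ps) (q ∷ qs) [ x₀ ] (cong suc eq))
      (weave-linked X~Y Y~X (All.++⁺ πs (∷-path [-] ∷ []))
        (All.++⁺ xs ((All.head (All.head xs) ∷ []) ∷ [])) σs ys balanced)
    where
    balanced : Balanced (((x₀ ∷ p) ∷ ps) ∷ʳ [ x₀ ]) (q ∷ qs)
    balanced = subst (λ m → suc (length qs) ≤ m × m ≤ suc (suc (length qs)))
      (sym (trans (length-∷ʳ ((x₀ ∷ p) ∷ ps) [ x₀ ]) (cong (suc ∘ suc) eq)))
      (n≤1+n _ , ≤-refl)

  closed-walk : ∀ {x z} xs → Linked R ((x ∷ xs) ∷ʳ z) →
                Linked R (x ∷ xs) × ∃[ y ] (last (x ∷ xs) ≡ just y × R y z)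
  closed-walk []       (r ∷ [-]) = [-] , _ , refl , r
  closed-walk (_ ∷ xs) (r ∷ rs)  with closed-walk xs rs
  ... | linked , closing = r ∷ linked , closing

  clique-linked : ∀ {P : A → Set} {xs} → (∀ {x y} → P x → P y → x ≢ y → R x y) →
                  All P xs → Unique xs → Linked R xs
  clique-linked _   []              []               = []
  clique-linked _   (_ ∷ [])        _                = [-]
  clique-linked adj (px ∷ py ∷ pxs) ((x≢y ∷ _) ∷ u) =
    adj px py x≢y ∷ clique-linked adj (py ∷ pxs) u

  clique-cycle : ∀ {P : A → Set} {x₀ x₁ xs} → (∀ {x y} → P x → P y → x ≢ y → R x y) →
                 All P (x₀ ∷ x₁ ∷ xs) → Unique (x₀ ∷ x₁ ∷ xs) →
                 Linked R ((x₀ ∷ x₁ ∷ xs) ∷ʳ x₀)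
  clique-cycle {x₀ = x₀} {x₁} {xs} adj ps@(p₀ ∷ ps₁) u@(x₀∉ ∷ _) =
    Linkedₚ.++⁺ (clique-linked adj ps u) closing [-]
    where
    others : All (λ y → _ × y ≢ x₀) (x₁ ∷ xs)
    others = All.zip (ps₁ , All.map (λ x₀≢y y≡x₀ → x₀≢y (sym y≡x₀)) x₀∉)
    closing : Connected R (last (x₀ ∷ x₁ ∷ xs)) (just x₀)
    closing = connected {Y = _≡ x₀} (λ { (py , y≢x₀) refl → adj py p₀ y≢x₀ })
                (All.last⁺ others) (Maybe.just refl)

-- Covers by at most two apart paths

record PathCover {A : Set} (R : A → A → Set) (L : List A) : Set where
  field
    paths     : List (List A)
    isPath    : All (IsPath R) paths
    covers    : concat paths ↭ L
    apart     : AllPairs (Apart R) paths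
    atMostTwo : length paths ≤ 2

open PathCover

module _ {A : Set} {R : A → A → Set} where

  empty-cover : PathCover R []
  empty-cover = record
    { paths = [] ; isPath = [] ; covers = ↭-refl ; apart = [] ; atMostTwo = z≤n }

  single-cover : ∀ {zs L} → Linked R zs → zs ≢ [] → zs ↭ L → PathCover R L
  single-cover {zs} lk nonEmpty zs↭L = record
    { paths = [ zs ] ; isPath = record { nonEmpty = nonEmpty ; linked = lk } ∷ []
    ; covers = ↭-trans (↭-reflexive (++-identityʳ zs)) zs↭L
    ; apart = [] ∷ [] ; atMostTwo = s≤s z≤n }

  apart-cover : ∀ {L M} → Linked R L → Linked R M → Apart R L M → PathCover R (L ++ M)
  apart-cover {[]}    {[]}    _  _  _ = empty-cover
  apart-cover {[]}    {_ ∷ _} _  lM _ = single-cover lM (λ ()) ↭-refl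
  apart-cover {_ ∷ _} {[]}    lL _  _ =
    single-cover lL (λ ()) (↭-reflexive (sym (++-identityʳ _)))
  apart-cover {L@(_ ∷ _)} {M@(_ ∷ _)} lL lM L∥M = record
    { paths = L ∷ M ∷ [] ; isPath = ∷-path lL ∷ ∷-path lM ∷ []
    ; covers = ++⁺ˡ L (↭-reflexive (++-identityʳ M))
    ; apart = (L∥M ∷ []) ∷ [] ∷ [] ; atMostTwo = ≤-refl }

  cover-resp-↭ : ∀ {L L′} → L ↭ L′ → PathCover R L → PathCover R L′
  cover-resp-↭ L↭L′ c = record
    { paths = paths c ; isPath = isPath c ; covers = ↭-trans (covers c) L↭L′
    ; apart = apart c ; atMostTwo = atMostTwo c }

  cover-All : ∀ {P : A → Set} {L} → All P L → (c : PathCover R L) → All (All P) (paths c)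
  cover-All allP c = All.concat⁻ (All-resp-↭ (↭-sym (covers c)) allP)

  1≤cover-paths : ∀ {x L} → x ∈ L → (c : PathCover R L) → 1 ≤ length (paths c)
  1≤cover-paths x∈L c with paths c | covers c
  ... | []    | cov with () ← ∈-resp-↭ (↭-sym cov) x∈L
  ... | _ ∷ _ | _   = s≤s z≤n

  weave-path : ∀ {X Y : A → Set} {ps qs} → Complete R X Y → Complete R Y X →
               All (IsPath R) ps → All (All X) ps → All (IsPath R) qs → All (All Y) qs →
               length ps ≤ suc (length qs) → length qs ≤ suc (length ps) →
               ∃[ zs ] (Linked R zs × zs ↭ concat ps ++ concat qs)
  weave-path {ps = ps} {qs} X~Y Y~X πs xs σs ys ps≲qs qs≲ps
    with ≤-total (length qs) (length ps)
  ... | inj₁ qs≤ps =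
    weave ps qs , weave-linked X~Y Y~X πs xs σs ys (qs≤ps , ps≲qs) , weave-↭ ps qs
  ... | inj₂ ps≤qs =
    weave qs ps , weave-linked Y~X X~Y σs ys πs xs (ps≤qs , qs≲ps) ,
    ↭-trans (weave-↭ qs ps) (++-comm (concat qs) (concat ps))

  join-path : ∀ {X Y : A → Set} {L M x y} → Complete R X Y → Complete R Y X →
              All X L → All Y M → x ∈ L → y ∈ M → PathCover R L → PathCover R M →
              ∃[ zs ] (Linked R zs × zs ↭ L ++ M)
  join-path X~Y Y~X inX inY x∈L y∈M c d
    with weave-path X~Y Y~X (isPath c) (cover-All inX c) (isPath d) (cover-All inY d)
           (≤-trans (atMostTwo c) (s≤s (1≤cover-paths y∈M d)))
           (≤-trans (atMostTwo d) (s≤s (1≤cover-paths x∈L c)))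
  ... | zs , lk , zs↭ = zs , lk , ↭-trans zs↭ (++⁺ (covers c) (covers d))

  join-cover : ∀ {X Y : A → Set} {L M} → Complete R X Y → Complete R Y X →
               All X L → All Y M → PathCover R L → PathCover R M → PathCover R (L ++ M)
  join-cover {L = []}                _ _ _ _ _ d = d
  join-cover {L = _ ∷ _} {M = []}    _ _ _ _ c _ =
    cover-resp-↭ (↭-reflexive (sym (++-identityʳ _))) c
  join-cover {L = _ ∷ _} {M = _ ∷ _} X~Y Y~X inX inY c d
    with join-path X~Y Y~X inX inY (here refl) (here refl) c d
  ... | zs , lk , zs↭ = single-cover lk (λ { refl → ¬x∷xs↭[] (↭-sym zs↭) }) zs↭

module _ {A : Set} where

  unique-⊆⇒length≤ : ∀ {xs ys : List A} → Unique xs → xs ⊆ ys → length xs ≤ length ys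
  unique-⊆⇒length≤ [] _ = z≤n
  unique-⊆⇒length≤ {x ∷ xs} (x∉xs ∷ u) xs⊆ys with ∈-∃++ (xs⊆ys (here refl))
  ... | as , bs , refl =
    subst (suc (length xs) ≤_) (sym (length-++-sucʳ as x bs))
      (s≤s (unique-⊆⇒length≤ u shrink))
    where
    shrink : xs ⊆ as ++ bs
    shrink {z} z∈xs with ∈-++⁻ as (xs⊆ys (there z∈xs))
    ... | inj₁ z∈as         = ∈-++⁺ˡ z∈as
    ... | inj₂ (here refl)  = ⊥-elim (All.lookup x∉xs z∈xs refl)
    ... | inj₂ (there z∈bs) = ∈-++⁺ʳ as z∈bs

  unique-++⁻ˡ : ∀ {xs ys : List A} → Unique (xs ++ ys) → Unique xs
  unique-++⁻ˡ {[]}     _         = []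
  unique-++⁻ˡ {x ∷ xs} (x∉ ∷ u) = All.++⁻ˡ xs x∉ ∷ unique-++⁻ˡ u

  unique-++⁻ʳ : ∀ xs {ys : List A} → Unique (xs ++ ys) → Unique ys
  unique-++⁻ʳ []       u       = u
  unique-++⁻ʳ (_ ∷ xs) (_ ∷ u) = unique-++⁻ʳ xs u

  unique-disjoint : ∀ {xs ys : List A} {z} → Unique (xs ++ ys) → z ∈ xs → z ∈ ys → ⊥
  unique-disjoint {_ ∷ xs} (x∉ ∷ _) (here refl)  z∈ys = All.lookup x∉ (∈-++⁺ʳ xs z∈ys) refl
  unique-disjoint          (_ ∷ u)  (there z∈xs) z∈ys = unique-disjoint u z∈xs z∈ys

  unique-resp-↭ : ∀ {xs ys : List A} → xs ↭ ys → Unique xs → Unique ys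
  unique-resp-↭ xs↭ys = Permutation.Unique-resp-↭ (setoid _) (↭⇒↭ₛ xs↭ys)

-- Components

module _ {n : ℕ} (G : Graph n) where

  reach-head : ∀ {P a b} → ReachIn G P a b → P a
  reach-head (here pa)     = pa
  reach-head (step pa _ _) = pa

  reach-closed : ∀ {P Q : Fin n → Set} → (∀ {a c} → Q a → Adj G a c → P c → Q c) →
                 ∀ {a b} → ReachIn G P a b → Q a → Q b
  reach-closed closed (here _)     qa = qa
  reach-closed closed (step _ e r) qa = reach-closed closed r (closed qa e (reach-head r))

  avoiding-closed : ∀ {v} → TwoConnectedComp G v → ∀ {x} {Q : Fin n → Set} →
                    (∀ {a c} → Q a → Adj G a c → InComp G v c → c ≢ x → Q c) →
                    ∀ {a b} → InComp G v x → InComp G v a → InComp G v b → a ≢ x → b ≢ x →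
                    Q a → Q b
  avoiding-closed (_ , connected) closed ix ia ib a≢x b≢x =
    reach-closed (λ qa e (ic , c≢x) → closed qa e ic c≢x) (connected _ _ _ ix ia ib a≢x b≢x)

  Enumerates : Fin n → List (Fin n) → Set
  Enumerates v C = Unique C × (∀ u → (u ∈ C) ⇔ InComp G v u)

  module _ {v C} (enum : Enumerates v C) where

    private
      uniqueC : Unique C
      uniqueC = proj₁ enum
      memC : ∀ u → (u ∈ C) ⇔ InComp G v u
      memC = proj₂ enum

    ∈⇔InComp : ∀ {xs} → xs ↭ C → ∀ u → (u ∈ xs) ⇔ InComp G v u
    ∈⇔InComp xs↭C u = mk⇔ (λ u∈xs → Equivalence.to (memC u) (∈-resp-↭ xs↭C u∈xs))
                          (λ ic → ∈-resp-↭ (↭-sym xs↭C) (Equivalence.from (memC u) ic))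

    hamPath-↭ : ∀ {xs} → xs ↭ C → Linked (Adj G) xs → HamPathOfComp G v
    hamPath-↭ xs↭C lk = _ , lk , unique-resp-↭ (↭-sym xs↭C) uniqueC , ∈⇔InComp xs↭C

    three≤length : TwoConnectedComp G v → 3 ≤ length C
    three≤length ((a , b , c , ia , ib , ic , a≢b , b≢c , a≢c) , _) =
      unique-⊆⇒length≤ {xs = a ∷ b ∷ c ∷ []} ((a≢b ∷ a≢c ∷ []) ∷ (b≢c ∷ []) ∷ [] ∷ [])
        λ { (here refl)                 → Equivalence.from (memC _) ia
          ; (there (here refl))         → Equivalence.from (memC _) ib
          ; (there (there (here refl))) → Equivalence.from (memC _) ic }

    hamCycle-↭ : ∀ {x₀ xs} → TwoConnectedComp G v → x₀ ∷ xs ↭ C →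
                 Linked (Adj G) ((x₀ ∷ xs) ∷ʳ x₀) → HamiltonianComp G v
    hamCycle-↭ {x₀} {xs} tc xs↭C lk with closed-walk xs lk
    ... | path , closing =
      x₀ , xs , subst (3 ≤_) (sym (↭-length xs↭C)) (three≤length tc) , path , closing ,
      unique-resp-↭ (↭-sym xs↭C) uniqueC , ∈⇔InComp xs↭C

-- Niche graphs of bipartite tournaments

module Niche {n : ℕ} (G : Graph n) (D : BipartiteTournament n) (niche : IsNicheGraphOf G D)
  where
  open BipartiteTournament D

  infix 4 _~_
  _~_ : Fin n → Fin n → Set
  a ~ b = Adj G a b

  ~-sym : ∀ {a b} → a ~ b → b ~ a
  ~-sym {a} {b} a~b = trans (Graph.sym G b a) a~b

  ~⇒niche : ∀ {a b} → a ~ b → NicheAdj D a b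
  ~⇒niche = Equivalence.to (niche _ _)

  arc⇒side≢ : ∀ {a w} → arc a w ≡ true → side a ≢ side w
  arc⇒side≢ {a} {w} a→w sa≡sw with () ← trans (sym a→w) (arc-same a w sa≡sw)

  reverse-arc : ∀ {a w} → side a ≢ side w → arc a w ≡ false → arc w a ≡ true
  reverse-arc {a} {w} sa≢sw a↛w with arc-diff a w sa≢sw
  ... | inj₁ a→w with () ← trans (sym a→w) a↛w
  ... | inj₂ w→a = w→a

  ~⇒common-opposite : ∀ {a b} → a ~ b → ∃[ w ] (side a ≢ side w × side b ≢ side w)
  ~⇒common-opposite a~b with ~⇒niche a~b
  ... | _ , inj₁ (w , a→w , b→w) = w , arc⇒side≢ a→w , arc⇒side≢ b→w
  ... | _ , inj₂ (w , w→a , w→b) =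
    w , (λ e → arc⇒side≢ w→a (sym e)) , (λ e → arc⇒side≢ w→b (sym e))

  ~⇒side≡ : ∀ {a b} → a ~ b → side a ≡ side b
  ~⇒side≡ a~b with ~⇒common-opposite a~b
  ... | _ , sa≢sw , sb≢sw = trans (Bool.¬-not sa≢sw) (sym (Bool.¬-not sb≢sw))

  isolated-component : ∀ {v} → (∀ y → side y ≡ side v) → Enumerates G v [ v ]
  isolated-component {v} one-side =
    ([] ∷ []) , λ u → mk⇔ (λ { (here refl) → here tt })
                          (λ ic → here (reach-closed G no-edge ic refl))
    where
    no-edge : ∀ {a c} → a ≡ v → a ~ c → _ → c ≡ v
    no-edge refl v~c _ with ~⇒common-opposite v~c
    ... | w , v≁w , _ = ⊥-elim (v≁w (sym (one-side w)))

  opposite-vertex? : ∀ v → (∃[ y ] side y ≢ side v) ⊎ (∀ y → side y ≡ side v)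
  opposite-vertex? v with Fin.any? (λ y → ¬? (side y Bool.≟ side v))
  ... | yes opposite = inj₁ opposite
  ... | no  none     =
    inj₂ λ y → decidable-stable (side y Bool.≟ side v) (λ y≁v → none (y , y≁v))

  module Profiles (s : Bool) where

    SameProfile OppositeProfile : Fin n → Fin n → Set
    SameProfile     a b = ∀ y → side y ≢ s → arc a y ≡ arc b y
    OppositeProfile a b = ∀ y → side y ≢ s → arc a y ≢ arc b y

    same? : ∀ a b → Dec (SameProfile a b)
    same? a b = Fin.all? λ y → ¬? (side y Bool.≟ s) →-dec (arc a y Bool.≟ arc b y)

    opposite? : ∀ a b → Dec (OppositeProfile a b)
    opposite? a b = Fin.all? λ y → ¬? (side y Bool.≟ s) →-dec ¬? (arc a y Bool.≟ arc b y)

    same-refl : ∀ {a} → SameProfile a a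
    same-refl _ _ = refl

    same-sym : ∀ {a b} → SameProfile a b → SameProfile b a
    same-sym ab y y≁ = sym (ab y y≁)

    same-trans : ∀ {a b c} → SameProfile a b → SameProfile b c → SameProfile a c
    same-trans ab bc y y≁ = trans (ab y y≁) (bc y y≁)

    opposite-sym : ∀ {a b} → OppositeProfile a b → OppositeProfile b a
    opposite-sym ab y y≁ e = ab y y≁ (sym e)

    same-opposite : ∀ {a b c} → SameProfile a b → OppositeProfile b c → OppositeProfile a c
    same-opposite ab bc y y≁ e = bc y y≁ (trans (sym (ab y y≁)) e)

    opposite-opposite : ∀ {a b c} → OppositeProfile a b → OppositeProfile b c →
                        SameProfile a c
    opposite-opposite ab bc y y≁ =
      trans (Bool.¬-not (ab y y≁)) (sym (Bool.¬-not (λ e → bc y y≁ (sym e))))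

    ~⇒¬opposite : ∀ {a b} → side a ≡ s → a ~ b → ¬ OppositeProfile a b
    ~⇒¬opposite sa a~b opp with ~⇒niche a~b
    ... | _ , inj₁ (w , a→w , b→w) =
      opp w (λ sw → arc⇒side≢ a→w (trans sa (sym sw))) (trans a→w (sym b→w))
    ... | _ , inj₂ (w , w→a , w→b) =
      opp w (λ sw → arc⇒side≢ w→a (trans sw (sym sa)))
            (trans (arc-asym w _ w→a) (sym (arc-asym w _ w→b)))

    ¬opposite⇒~ : ∀ {a b} → side a ≡ s → side b ≡ s → a ≢ b → ¬ OppositeProfile a b → a ~ b
    ¬opposite⇒~ {a} {b} sa sb a≢b ¬opp
      with Fin.any? (λ y → ¬? (side y Bool.≟ s) ×-dec (arc a y Bool.≟ arc b y))
    ... | no none = ⊥-elim (¬opp λ y y≁ agree → none (y , y≁ , agree))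
    ... | yes (y , y≁ , agree) = Equivalence.from (niche a b) (a≢b , common (arc a y) refl)
      where
      a≁y : side a ≢ side y
      a≁y e = y≁ (trans (sym e) sa)
      b≁y : side b ≢ side y
      b≁y e = y≁ (trans (sym e) sb)
      common : ∀ c → arc a y ≡ c → (∃[ w ] (arc a w ≡ true × arc b w ≡ true))
                                  ⊎ (∃[ w ] (arc w a ≡ true × arc w b ≡ true))
      common true  a→y = inj₁ (y , a→y , trans (sym agree) a→y)
      common false a↛y =
        inj₂ (y , reverse-arc a≁y a↛y , reverse-arc b≁y (trans (sym agree) a↛y))

  module Classes (s : Bool) (y₀ : Fin n) (y₀≁ : side y₀ ≢ s) where
    open Profiles s

    same⇒¬opposite : ∀ {a b} → SameProfile a b → ¬ OppositeProfile a b
    same⇒¬opposite ab opp = opp y₀ y₀≁ (ab y₀ y₀≁)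

    OnSide : Fin n → Set
    OnSide x = side x ≡ s

    Twin Antitwin Mixed Unmixed : Fin n → Fin n → Set
    Twin     p x = OnSide x × SameProfile p x
    Antitwin p x = OnSide x × OppositeProfile p x
    Mixed    p x = OnSide x × ¬ SameProfile p x × ¬ OppositeProfile p x
    Unmixed  p x = Twin p x ⊎ Antitwin p x

    twin? : ∀ p x → Dec (Twin p x)
    twin? p x = (side x Bool.≟ s) ×-dec same? p x

    antitwin? : ∀ p x → Dec (Antitwin p x)
    antitwin? p x = (side x Bool.≟ s) ×-dec opposite? p x

    mixed? : ∀ p x → Dec (Mixed p x)
    mixed? p x = (side x Bool.≟ s) ×-dec ¬? (same? p x) ×-dec ¬? (opposite? p x)

    classify : ∀ p {x} → OnSide x → Twin p x ⊎ Antitwin p x ⊎ Mixed p x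
    classify p {x} sx with same? p x | opposite? p x
    ... | yes same | _       = inj₁ (sx , same)
    ... | no ¬same | yes opp = inj₂ (inj₁ (sx , opp))
    ... | no ¬same | no ¬opp = inj₂ (inj₂ (sx , ¬same , ¬opp))

    twin⇒¬antitwin : ∀ {p x} → Twin p x → ¬ Antitwin p x
    twin⇒¬antitwin (_ , same) (_ , opp) = same⇒¬opposite same opp

    twin⇒¬mixed : ∀ {p x} → Twin p x → ¬ Mixed p x
    twin⇒¬mixed (_ , same) (_ , ¬same , _) = ¬same same

    antitwin⇒¬mixed : ∀ {p x} → Antitwin p x → ¬ Mixed p x
    antitwin⇒¬mixed (_ , opp) (_ , _ , ¬opp) = ¬opp opp

    twin~twin : ∀ {p x y} → Twin p x → Twin p y → x ≢ y → x ~ y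
    twin~twin (sx , px) (sy , py) x≢y =
      ¬opposite⇒~ sx sy x≢y (same⇒¬opposite (same-trans (same-sym px) py))

    antitwin~antitwin : ∀ {p x y} → Antitwin p x → Antitwin p y → x ≢ y → x ~ y
    antitwin~antitwin (sx , px) (sy , py) x≢y =
      ¬opposite⇒~ sx sy x≢y (same⇒¬opposite (opposite-opposite (opposite-sym px) py))

    twin~mixed : ∀ {p x y} → Twin p x → Mixed p y → x ~ y
    twin~mixed (sx , px) (sy , ¬py , ¬opy) =
      ¬opposite⇒~ sx sy (λ { refl → ¬py px }) (λ xy → ¬opy (same-opposite px xy))

    antitwin~mixed : ∀ {p x y} → Antitwin p x → Mixed p y → x ~ y
    antitwin~mixed (sx , px) (sy , ¬py , ¬opy) =
      ¬opposite⇒~ sx sy (λ { refl → ¬opy px }) (λ xy → ¬py (opposite-opposite px xy))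

    unmixed~mixed : ∀ {p} → Complete _~_ (Unmixed p) (Mixed p)
    unmixed~mixed (inj₁ t) m = twin~mixed t m
    unmixed~mixed (inj₂ a) m = antitwin~mixed a m

    mixed~unmixed : ∀ {p} → Complete _~_ (Mixed p) (Unmixed p)
    mixed~unmixed m c = ~-sym (unmixed~mixed c m)

    twin≁antitwin : ∀ {p x y} → Twin p x → Antitwin p y → ¬ x ~ y
    twin≁antitwin (sx , px) (_ , py) x~y =
      ~⇒¬opposite sx x~y (same-opposite (same-sym px) py)

    twins antitwins mixeds : Fin n → List (Fin n) → List (Fin n)
    twins     p = filter (twin? p)
    antitwins p = filter (antitwin? p)
    mixeds    p = filter (mixed? p)

    decompose : ∀ p {L} → All OnSide L → L ↭ twins p L ++ antitwins p L ++ mixeds p L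
    decompose p [] = ↭-refl
    decompose p {x ∷ L} (sx ∷ sL) with classify p sx
    ... | inj₁ t
      rewrite filter-accept (twin? p) {xs = L} t
            | filter-reject (antitwin? p) {xs = L} (twin⇒¬antitwin t)
            | filter-reject (mixed? p) {xs = L} (twin⇒¬mixed t)
      = ↭-prep x (decompose p sL)
    ... | inj₂ (inj₁ a)
      rewrite filter-reject (twin? p) {xs = L} (λ t → twin⇒¬antitwin t a)
            | filter-accept (antitwin? p) {xs = L} a
            | filter-reject (mixed? p) {xs = L} (antitwin⇒¬mixed a)
      = ↭-trans (↭-prep x (decompose p sL)) (↭-sym (shift x (twins p L) _))
    ... | inj₂ (inj₂ m)
      rewrite filter-reject (twin? p) {xs = L} (λ t → twin⇒¬mixed t m)
            | filter-reject (antitwin? p) {xs = L} (λ a → antitwin⇒¬mixed a m)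
            | filter-accept (mixed? p) {xs = L} m
      = begin
        x ∷ L                                          ↭⟨ ↭-prep x (decompose p sL) ⟩
        x ∷ twins p L ++ antitwins p L ++ mixeds p L   ↭⟨ shift x (twins p L) _ ⟨
        twins p L ++ x ∷ antitwins p L ++ mixeds p L   ↭⟨ ++⁺ˡ (twins p L)
                                                              (shift x (antitwins p L) _) ⟨
        twins p L ++ antitwins p L ++ x ∷ mixeds p L   ∎
      where open PermutationReasoning

    twin-antitwin-cover : ∀ {p S T} → All (Twin p) S → All (Antitwin p) T →
                          Unique S → Unique T → PathCover _~_ (S ++ T)
    twin-antitwin-cover tS aT uS uT =
      apart-cover (clique-linked twin~twin tS uS) (clique-linked antitwin~antitwin aT uT)
        (λ x∈S y∈T → twin≁antitwin (All.lookup tS x∈S) (All.lookup aT y∈T))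

    side-cover : ∀ {L} → Unique L → All OnSide L → PathCover _~_ L
    side-cover {L} = go (length L) ≤-refl
      where
      go : ∀ k {L} → length L ≤ k → Unique L → All OnSide L → PathCover _~_ L
      go _       {[]}    _         _          _         = empty-cover
      go (suc k) {r ∷ L} (s≤s L≤k) (r∉L ∷ uL) (sr ∷ sL) =
        cover-resp-↭ reassemble
          (join-cover unmixed~mixed mixed~unmixed
             (All.++⁺ (All.map inj₁ tS) (All.map inj₂ aT)) (All.all-filter (mixed? r) L)
             (twin-antitwin-cover tS aT uS (Unique.filter⁺ (antitwin? r) uL))
             (go k (≤-trans (length-filter (mixed? r) L) L≤k) (Unique.filter⁺ (mixed? r) uL)
                (All.filter⁺ (mixed? r) sL)))
        where
        tS : All (Twin r) (r ∷ twins r L)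
        tS = (sr , same-refl) ∷ All.all-filter (twin? r) L
        aT : All (Antitwin r) (antitwins r L)
        aT = All.all-filter (antitwin? r) L
        uS : Unique (r ∷ twins r L)
        uS = All.filter⁺ (twin? r) r∉L ∷ Unique.filter⁺ (twin? r) uL
        reassemble : ((r ∷ twins r L) ++ antitwins r L) ++ mixeds r L ↭ r ∷ L
        reassemble =
          ↭-prep r (↭-trans (↭-reflexive (++-assoc (twins r L) _ _)) (↭-sym (decompose r sL)))

    module Component (v : Fin n) (sv : OnSide v) where

      record Decomposition : Set where
        field
          S T M    : List (Fin n)
          twin     : All (Twin v) S
          antitwin : All (Antitwin v) T
          mixed    : All (Mixed v) M
          unique   : Unique (S ++ T ++ M)
          complete : ∀ {u} → OnSide u → u ∈ S ++ T ++ M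

      decomposition : Decomposition
      decomposition = record
        { S = twins v Vs ; T = antitwins v Vs ; M = mixeds v Vs
        ; twin = All.all-filter (twin? v) Vs
        ; antitwin = All.all-filter (antitwin? v) Vs
        ; mixed = All.all-filter (mixed? v) Vs
        ; unique = unique-resp-↭ (decompose v onSide)
                     (Unique.filter⁺ (side? s) (Unique.allFin⁺ n))
        ; complete = λ su → ∈-resp-↭ (decompose v onSide) (∈-filter⁺ (side? s) (∈-allFin _) su)
        }
        where
        side? : ∀ s x → Dec (side x ≡ s)
        side? s x = side x Bool.≟ s
        Vs : List (Fin n)
        Vs = filter (side? s) (allFin n)
        onSide : All OnSide Vs
        onSide = All.all-filter (side? s) (allFin n)

      module Decomposed (d : Decomposition) where
        open Decomposition d public

        S-unique : Unique S
        S-unique = unique-++⁻ˡ unique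

        T-unique : Unique T
        T-unique = unique-++⁻ˡ (unique-++⁻ʳ S unique)

        M-unique : Unique M
        M-unique = unique-++⁻ʳ T (unique-++⁻ʳ S unique)

        split∈ : ∀ {u} → u ∈ S ++ T ++ M → u ∈ S ⊎ u ∈ T ⊎ u ∈ M
        split∈ u∈ with ∈-++⁻ S u∈
        ... | inj₁ u∈S  = inj₁ u∈S
        ... | inj₂ u∈TM = inj₂ (∈-++⁻ T u∈TM)

        twin∈S : ∀ {u} → Twin v u → u ∈ S
        twin∈S t with split∈ (complete (proj₁ t))
        ... | inj₁ u∈S        = u∈S
        ... | inj₂ (inj₁ u∈T) = ⊥-elim (twin⇒¬antitwin t (All.lookup antitwin u∈T))
        ... | inj₂ (inj₂ u∈M) = ⊥-elim (twin⇒¬mixed t (All.lookup mixed u∈M))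

        antitwin∈T : ∀ {u} → Antitwin v u → u ∈ T
        antitwin∈T a with split∈ (complete (proj₁ a))
        ... | inj₁ u∈S        = ⊥-elim (twin⇒¬antitwin (All.lookup twin u∈S) a)
        ... | inj₂ (inj₁ u∈T) = u∈T
        ... | inj₂ (inj₂ u∈M) = ⊥-elim (antitwin⇒¬mixed a (All.lookup mixed u∈M))

        mixed∈M : ∀ {u} → Mixed v u → u ∈ M
        mixed∈M m with split∈ (complete (proj₁ m))
        ... | inj₁ u∈S        = ⊥-elim (twin⇒¬mixed (All.lookup twin u∈S) m)
        ... | inj₂ (inj₁ u∈T) = ⊥-elim (antitwin⇒¬mixed (All.lookup antitwin u∈T) m)
        ... | inj₂ (inj₂ u∈M) = u∈M

        v-twin : Twin v v
        v-twin = sv , same-refl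

        v∈S : v ∈ S
        v∈S = twin∈S v-twin

        unmixed : All (Unmixed v) (S ++ T)
        unmixed = All.++⁺ (All.map inj₁ twin) (All.map inj₂ antitwin)

        S-linked : Linked _~_ S
        S-linked = clique-linked twin~twin twin S-unique

        T-linked : Linked _~_ T
        T-linked = clique-linked antitwin~antitwin antitwin T-unique

        S,T↭ : concat (S ∷ T ∷ []) ↭ S ++ T
        S,T↭ = ↭-reflexive (cong (S ++_) (++-identityʳ T))

        M-cover : PathCover _~_ M
        M-cover = side-cover M-unique (All.map proj₁ mixed)

        inComp⇒onSide : ∀ {u} → InComp G v u → OnSide u
        inComp⇒onSide ic = reach-closed G (λ sa a~c _ → trans (sym (~⇒side≡ a~c)) sa) ic sv

        twin-reachable : ∀ {u} → Twin v u → InComp G v u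
        twin-reachable {u} t with u ≟ v
        ... | yes refl = here tt
        ... | no u≢v   = step tt (twin~twin v-twin t (λ v≡u → u≢v (sym v≡u))) (here tt)

        side-component : ∀ {z} → z ∈ M → Enumerates G v (S ++ T ++ M)
        side-component z∈M = unique , λ u → mk⇔ reach (complete ∘ inComp⇒onSide)
          where
          z-mixed : Mixed v _
          z-mixed = All.lookup mixed z∈M
          reach : ∀ {u} → u ∈ S ++ T ++ M → InComp G v u
          reach u∈ with split∈ u∈
          ... | inj₁ u∈S        = twin-reachable (All.lookup twin u∈S)
          ... | inj₂ (inj₁ u∈T) =
            step tt (twin~mixed v-twin z-mixed)
              (step tt (~-sym (antitwin~mixed (All.lookup antitwin u∈T) z-mixed)) (here tt))
          ... | inj₂ (inj₂ u∈M) = step tt (twin~mixed v-twin (All.lookup mixed u∈M)) (here tt)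

        twins-component : M ≡ [] → Enumerates G v S
        twins-component M≡[] =
          S-unique , λ u → mk⇔ (twin-reachable ∘ All.lookup twin)
                               (λ ic → twin∈S (reach-closed G closed ic v-twin))
          where
          closed : ∀ {a c} → Twin v a → a ~ c → _ → Twin v c
          closed ta a~c _ with classify v (trans (sym (~⇒side≡ a~c)) (proj₁ ta))
          ... | inj₁ tc        = tc
          ... | inj₂ (inj₁ ac) = ⊥-elim (twin≁antitwin ta ac a~c)
          ... | inj₂ (inj₂ mc) with () ← subst (_ ∈_) M≡[] (mixed∈M mc)

        hamPath-via-mixed : ∀ {z} → z ∈ M → HamPathOfComp G v
        hamPath-via-mixed z∈M
          with join-path unmixed~mixed mixed~unmixed unmixed mixed (∈-++⁺ˡ v∈S) z∈M
                 (twin-antitwin-cover twin antitwin S-unique T-unique) M-cover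
        ... | zs , lk , zs↭ =
          hamPath-↭ G (side-component z∈M) (↭-trans zs↭ (↭-reflexive (++-assoc S T M))) lk

        weave-hamCycle : TwoConnectedComp G v → ∀ {z x₀ p ps q qs} → z ∈ M →
                         All (IsPath _~_) ((x₀ ∷ p) ∷ ps) → All (IsPath _~_) (q ∷ qs) →
                         concat ((x₀ ∷ p) ∷ ps) ↭ S ++ T → concat (q ∷ qs) ↭ M →
                         length ps ≡ length qs → HamiltonianComp G v
        weave-hamCycle tc {x₀ = x₀} {p} {ps} {q} {qs} z∈M πs σs ps↭ qs↭ eq =
          hamCycle-↭ G (side-component z∈M) tc
            (↭-trans (weave-↭ ((x₀ ∷ p) ∷ ps) (q ∷ qs))
               (↭-trans (++⁺ ps↭ qs↭) (↭-reflexive (++-assoc S T M))))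
            (weave-cycle unmixed~mixed mixed~unmixed
               πs (All.concat⁻ (All-resp-↭ (↭-sym ps↭) unmixed))
               σs (All.concat⁻ (All-resp-↭ (↭-sym qs↭) mixed)) eq)

        -- Otherwise r would be a cut vertex separating v from the antitwin t.
        lone-mixed : TwoConnectedComp G v → ∀ {t r} → t ∈ T → [ r ] ↭ M → ⊥
        lone-mixed tc {t} {r} t∈T r↭M =
          twin⇒¬antitwin
            (avoiding-closed G tc closed (reach (∈-++⁺ʳ S (∈-++⁺ʳ T r∈M))) (here tt)
               (reach (∈-++⁺ʳ S (∈-++⁺ˡ t∈T)))
               (λ { refl → twin⇒¬mixed v-twin r-mixed })
               (λ { refl → antitwin⇒¬mixed t-anti r-mixed }) v-twin)
            t-anti
          where
          r∈M : r ∈ M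
          r∈M = ∈-resp-↭ r↭M (here refl)
          t-anti : Antitwin v t
          t-anti = All.lookup antitwin t∈T
          r-mixed : Mixed v r
          r-mixed = All.lookup mixed r∈M
          reach : ∀ {u} → u ∈ S ++ T ++ M → InComp G v u
          reach = Equivalence.to (proj₂ (side-component r∈M) _)
          closed : ∀ {a c} → Twin v a → a ~ c → InComp G v c → c ≢ r → Twin v c
          closed ta a~c ic c≢r with classify v (inComp⇒onSide ic)
          ... | inj₁ tc        = tc
          ... | inj₂ (inj₁ ac) = ⊥-elim (twin≁antitwin ta ac a~c)
          ... | inj₂ (inj₂ mc) with ∈-resp-↭ (↭-sym r↭M) (mixed∈M mc)
          ...   | here c≡r = ⊥-elim (c≢r c≡r)

        -- Otherwise v would be a cut vertex separating the two mixed paths.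
        lone-twin : TwoConnectedComp G v → ∀ {s₁} → S ≡ [ s₁ ] → T ≡ [] →
                    ∀ {q₁ q₂ r₁ r₂} → concat (q₁ ∷ q₂ ∷ []) ↭ M → Apart _~_ q₁ q₂ →
                    r₁ ∈ q₁ → r₂ ∈ q₂ → ⊥
        lone-twin tc S≡[s₁] T≡[] {q₁} {q₂} {r₁} {r₂} q↭M q₁∥q₂ r₁∈q₁ r₂∈q₂ =
          unique-disjoint (unique-resp-↭ (↭-sym q↭M) M-unique) r₂∈q₁ (∈-++⁺ˡ r₂∈q₂)
          where
          in-M : ∀ {u} → u ∈ q₁ ⊎ u ∈ q₂ → u ∈ M
          in-M (inj₁ u∈q₁) = ∈-resp-↭ q↭M (∈-++⁺ˡ u∈q₁)
          in-M (inj₂ u∈q₂) = ∈-resp-↭ q↭M (∈-++⁺ʳ q₁ (∈-++⁺ˡ u∈q₂))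
          in-q : ∀ {u} → u ∈ M → u ∈ q₁ ⊎ u ∈ q₂
          in-q u∈M with ∈-++⁻ q₁ (∈-resp-↭ (↭-sym q↭M) u∈M)
          ... | inj₁ u∈q₁   = inj₁ u∈q₁
          ... | inj₂ u∈q₂[] with ∈-++⁻ q₂ u∈q₂[]
          ...   | inj₁ u∈q₂ = inj₂ u∈q₂
          only-v : ∀ {u} → Twin v u → u ≡ v
          only-v t with subst (_ ∈_) S≡[s₁] (twin∈S t) | subst (_ ∈_) S≡[s₁] v∈S
          ... | here refl | here refl = refl
          reach : ∀ {u} → u ∈ M → InComp G v u
          reach u∈M = Equivalence.to (proj₂ (side-component u∈M) _) (∈-++⁺ʳ S (∈-++⁺ʳ T u∈M))
          ≢v : ∀ {u} → u ∈ M → u ≢ v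
          ≢v u∈M refl = twin⇒¬mixed v-twin (All.lookup mixed u∈M)
          closed : ∀ {a c} → a ∈ q₁ → a ~ c → InComp G v c → c ≢ v → c ∈ q₁
          closed a∈q₁ a~c ic c≢v with classify v (inComp⇒onSide ic)
          ... | inj₁ tc        = ⊥-elim (c≢v (only-v tc))
          ... | inj₂ (inj₁ ac) with () ← subst (_ ∈_) T≡[] (antitwin∈T ac)
          closed a∈q₁ a~c ic c≢v | inj₂ (inj₂ mc) with in-q (mixed∈M mc)
          ... | inj₁ c∈q₁ = c∈q₁
          ... | inj₂ c∈q₂ = ⊥-elim (q₁∥q₂ a∈q₁ c∈q₂ a~c)
          r₁∈M : r₁ ∈ M
          r₁∈M = in-M (inj₁ r₁∈q₁)
          r₂∈M : r₂ ∈ M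
          r₂∈M = in-M (inj₂ r₂∈q₂)
          r₂∈q₁ : r₂ ∈ q₁
          r₂∈q₁ = avoiding-closed G tc closed (here tt) (reach r₁∈M) (reach r₂∈M)
                    (≢v r₁∈M) (≢v r₂∈M) r₁∈q₁

      hamPath-from : Decomposition → HamPathOfComp G v
      hamPath-from d@record { M = [] }    = hamPath-↭ G (twins-component refl) ↭-refl S-linked
        where open Decomposed d
      hamPath-from d@record { M = _ ∷ _ } = hamPath-via-mixed (here refl)
        where open Decomposed d

      hamCycle-within-twins : (d : Decomposition) → Decomposition.M d ≡ [] →
                              TwoConnectedComp G v → HamiltonianComp G v
      hamCycle-within-twins d@record { S = [] } _ _ with () ← Decomposed.v∈S d
      hamCycle-within-twins d@record { S = _ ∷ [] } M≡[] tc
        with s≤s () ← three≤length G (Decomposed.twins-component d M≡[]) tc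
      hamCycle-within-twins d@record { S = _ ∷ _ ∷ _ } M≡[] tc =
        hamCycle-↭ G (twins-component M≡[]) tc ↭-refl (clique-cycle twin~twin twin S-unique)
        where open Decomposed d

      hamCycle-via-mixed : (d : Decomposition) → ∀ {z} → z ∈ Decomposition.M d →
                           PathCover _~_ (Decomposition.M d) →
                           TwoConnectedComp G v → HamiltonianComp G v
      hamCycle-via-mixed d@record { S = [] } _ _ _ with () ← Decomposed.v∈S d
      hamCycle-via-mixed _ z∈M record { paths = [] ; covers = []↭M } _
        with () ← ∈-resp-↭ (↭-sym []↭M) z∈M
      hamCycle-via-mixed _ _ record { paths = _ ∷ _ ∷ _ ∷ _ ; atMostTwo = s≤s (s≤s ()) } _
      hamCycle-via-mixed _ _ record { paths = [] ∷ _ ; isPath = σ ∷ _ } _ =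
        ⊥-elim (nonEmpty σ refl)
      hamCycle-via-mixed d@record { S = _ ∷ _ ; T = [] } z∈M
                         record { paths = _ ∷ [] ; isPath = σs ; covers = q↭M } tc =
        weave-hamCycle tc z∈M (∷-path S-linked ∷ []) σs ↭-refl q↭M refl
        where open Decomposed d
      hamCycle-via-mixed d@record { T = _ ∷ _ } _
                         record { paths = (_ ∷ []) ∷ [] ; covers = q↭M } tc =
        ⊥-elim (Decomposed.lone-mixed d tc (here refl) q↭M)
      hamCycle-via-mixed d@record { S = _ ∷ _ ; T = _ ∷ _ } z∈M
                         record { paths = (_ ∷ _ ∷ _) ∷ [] ; isPath = σ ∷ [] ; covers = q↭M } tc =
        weave-hamCycle tc z∈M (∷-path S-linked ∷ ∷-path T-linked ∷ [])
          (∷-path [-] ∷ ∷-path (Linked.tail (linked σ)) ∷ []) S,T↭ q↭M refl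
        where open Decomposed d
      hamCycle-via-mixed d@record { S = _ ∷ _ ; T = _ ∷ _ } z∈M
                         record { paths = _ ∷ _ ∷ [] ; isPath = σs ; covers = q↭M } tc =
        weave-hamCycle tc z∈M (∷-path S-linked ∷ ∷-path T-linked ∷ []) σs S,T↭ q↭M refl
        where open Decomposed d
      hamCycle-via-mixed d@record { S = _ ∷ [] ; T = [] } _
                         record { paths = _ ∷ _ ∷ [] ; isPath = σ₁ ∷ σ₂ ∷ []
                                ; covers = q↭M ; apart = (q₁∥q₂ ∷ []) ∷ _ } tc =
        ⊥-elim (Decomposed.lone-twin d tc refl refl q↭M q₁∥q₂
                  (proj₂ (path-member σ₁)) (proj₂ (path-member σ₂)))
      hamCycle-via-mixed d@record { S = _ ∷ _ ∷ _ ; T = [] } z∈M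
                         record { paths = _ ∷ _ ∷ [] ; isPath = σs ; covers = q↭M } tc =
        weave-hamCycle tc z∈M (∷-path [-] ∷ ∷-path (Linked.tail S-linked) ∷ []) σs ↭-refl q↭M refl
        where open Decomposed d

      hamPath : HamPathOfComp G v
      hamPath = hamPath-from decomposition

      hamCycle : TwoConnectedComp G v → HamiltonianComp G v
      hamCycle with Decomposition.M decomposition in eq
      ... | []    = hamCycle-within-twins decomposition eq
      ... | z ∷ _ = hamCycle-via-mixed decomposition (subst (z ∈_) (sym eq) (here refl))
                      (Decomposed.M-cover decomposition)

  hamPath : ∀ v → HamPathOfComp G v
  hamPath v with opposite-vertex? v
  ... | inj₁ (y₀ , y₀≁) = Classes.Component.hamPath (side v) y₀ y₀≁ v refl
  ... | inj₂ one-side   = hamPath-↭ G (isolated-component one-side) ↭-refl [-]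

  hamCycle : ∀ v → TwoConnectedComp G v → HamiltonianComp G v
  hamCycle v tc with opposite-vertex? v
  ... | inj₁ (y₀ , y₀≁) = Classes.Component.hamCycle (side v) y₀ y₀≁ v refl tc
  ... | inj₂ one-side with s≤s () ← three≤length G (isolated-component one-side) tc

theorem4p8 : ∀ {n : ℕ} (G : Graph n) → NicheRealizable G →
    (∀ (v : Fin n) → HamPathOfComp G v)
    × (∀ (v : Fin n) → TwoConnectedComp G v → HamiltonianComp G v)
theorem4p8 G (D , niche) = hamPath , hamCycle
  where open Niche G D niche
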